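{- Let $a$ and $b$ be coprime positive integers and let $\ell \in G_{(a,b)}\setminus\{1,2\}$. Then $\mathrm{ord}_{\ell}(ab^{ -1})$ is even, \[\min \mathcal{K}_{(a,b)}(\ell) = \frac{\mathrm{ord}_{\ell}(ab^{ -1})}{2},\] and \[\mathcal{K}_{(a,b)}(\ell) = \Bigl\{\alpha\cdot \frac{\mathrm{ord}_{\ell}(ab^{ -1})}{2} : \alpha \text{ an odd positive integer}\Bigr\},\] which is an infinite set.
   Context: For coprime nonzero integers $a,b$, a positive integer $\ell$ is called good with respect to $a$ and $b$ if there is a positive integer $k$ with $\ell \mid (a^k+b^k)$; $G_{(a,b)}$ denotes the set of such good integers, and for $\ell\in G_{(a,b)}$, $\mathcal{K}_{(a,b)}(\ell)=\{k\in\mathbb{N} : \ell \mid (a^k+b^k)\}$ is its set of admissible exponents ($\mathbb{N}$ = positive integers). For $\ell\in G_{(a,b)}$ one has $\gcd(\ell,ab)=1$, so $b$ is invertible modulo $\ell$, and $\mathrm{ord}_{\ell}(ab^{ -1})$ denotes the multiplicative order of $a b^{ -1}$ modulo $\ell$. -}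

module Defs where

open import Data.Nat using (ℕ; _+_; _*_; _^_; _≤_; _<_; NonZero)
open import Data.Nat.DivMod using (_%_)
open import Data.Nat.Divisibility using (_∣_)
open import Data.Product using (_×_; ∃-syntax)

InK : ℕ → ℕ → ℕ → ℕ → Set
InK a b ℓ k = 1 ≤ k × ℓ ∣ a ^ k + b ^ k

Good : ℕ → ℕ → ℕ → Set
Good a b ℓ = 1 ≤ ℓ × ∃[ k ] InK a b ℓ k

_≡[mod_]_ : ℕ → (m : ℕ) → .{{NonZero m}} → ℕ → Set
x ≡[mod m ] y = x % m ≡ y % m
  where open import Relation.Binary.PropositionalEquality using (_≡_)

IsInverseMod : (m : ℕ) → .{{NonZero m}} → ℕ → ℕ → Set
IsInverseMod m b b' = (b * b') ≡[mod m ] 1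

IsOrderMod : (m : ℕ) → .{{NonZero m}} → ℕ → ℕ → Set
IsOrderMod m x n =
  1 ≤ n × (x ^ n) ≡[mod m ] 1 × (∀ j → 1 ≤ j → (x ^ j) ≡[mod m ] 1 → n ≤ j)

{-# OPTIONS --safe #-}
-- Put x = a b⁻¹. Multiplying by b⁻ᵏ shows ℓ ∣ aᵏ + bᵏ iff xᵏ ≡ -1 (mod ℓ). If xᵏ ≡ -1
-- and n = ord x, then also xʳ ≡ -1 for r = k mod n; r ≠ 0 because ℓ ∤ 2, and x²ʳ ≡ 1
-- gives n ∣ 2r with 0 < 2r < 2n, so n = 2r. Hence the exponents with xᵏ ≡ -1 are
-- exactly the k ≡ r (mod 2r), i.e. the odd multiples of r = n/2.
module Submission where

open import Defs
open import Data.Nat using (ℕ; zero; suc; pred; _+_; _*_; _^_; _≤_; _<_; z≤n; s≤s; NonZero; >-nonZero)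
open import Data.Nat.Coprimality using (Coprime)
open import Data.Nat.DivMod using (_%_; _/_; %-distribˡ-+; %-distribˡ-*; [m+kn]%n≡m%n; m*n%n≡0; m≡m%n+[m/n]*n; m%n<n; m<n⇒m%n≡m)
open import Data.Nat.Divisibility using (_∣_; divides; m%n≡0⇔n∣m)
open import Data.Nat.Properties using (+-comm; +-assoc; +-identityʳ; *-comm; *-assoc; *-distribʳ-+; *-identityʳ; *-zeroʳ; *-suc; suc-pred; [m*n]*[o*p]≡[m*o]*[n*p]; ^-zeroˡ; ^-distribˡ-+-*; ^-*-assoc; *-cancelˡ-≡; *-monoʳ-<; *-monoˡ-≤; m≤m+n; m≤m*n; 1+n≢0; ≤-trans; <⇒≱; <-irrefl; module ≤-Reasoning)
open import Data.Nat.Tactic.RingSolver using (solve-∀)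
open import Data.Product using (_×_; _,_; proj₁; proj₂; ∃-syntax)
open import Data.Empty using (⊥-elim)
open import Function.Bundles using (_⇔_; mk⇔; Equivalence)
import Function.Properties.Equivalence as ⇔
open import Relation.Binary.PropositionalEquality using (_≡_; _≢_; refl; sym; trans; cong; cong₂; subst; module ≡-Reasoning)

infix 4 _≡-1[mod_]

-- y ≡ -1 (mod m), stated without subtraction
_≡-1[mod_] : ℕ → (m : ℕ) → .{{NonZero m}} → Set
y ≡-1[mod m ] = (y + 1) ≡[mod m ] 0

^-distribʳ-* : ∀ a b k → (a * b) ^ k ≡ a ^ k * b ^ k
^-distribʳ-* a b zero    = refl
^-distribʳ-* a b (suc k) = begin
  a * b * (a * b) ^ k        ≡⟨ cong (a * b *_) (^-distribʳ-* a b k) ⟩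
  a * b * (a ^ k * b ^ k)    ≡⟨ [m*n]*[o*p]≡[m*o]*[n*p] a b (a ^ k) (b ^ k) ⟩
  a * a ^ k * (b * b ^ k)    ∎
  where open ≡-Reasoning

≢1∧≢2⇒2< : ∀ m .{{_ : NonZero m}} → m ≢ 1 → m ≢ 2 → 2 < m
≢1∧≢2⇒2< 1                   m≢1 _   = ⊥-elim (m≢1 refl)
≢1∧≢2⇒2< 2                   _   m≢2 = ⊥-elim (m≢2 refl)
≢1∧≢2⇒2< (suc (suc (suc _))) _   _   = s≤s (s≤s (s≤s z≤n))

n∣2r⇒n≡2r : ∀ {n r} → 0 < r → r < n → n ∣ 2 * r → n ≡ 2 * r
n∣2r⇒n≡2r {r = suc _} _ _ (divides 0 ())
n∣2r⇒n≡2r {n}         _ _ (divides 1 2r≡n+0) = sym (trans 2r≡n+0 (+-identityʳ n))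
n∣2r⇒n≡2r {n} {r}     _ r<n (divides (suc (suc c)) 2r≡[2+c]n) = ⊥-elim (<-irrefl refl (begin-strict
  2 * r                <⟨ *-monoʳ-< 2 r<n ⟩
  2 * n                ≤⟨ *-monoˡ-≤ n {2} {suc (suc c)} (s≤s (s≤s z≤n)) ⟩
  suc (suc c) * n      ≡⟨ 2r≡[2+c]n ⟨
  2 * r                ∎))
  where open ≤-Reasoning

module ModularArithmetic (m : ℕ) .{{_ : NonZero m}} where
  open ≡-Reasoning

  +-cong : ∀ {a b c d} → a ≡[mod m ] b → c ≡[mod m ] d → (a + c) ≡[mod m ] (b + d)
  +-cong {a} {b} {c} {d} a≡b c≡d = begin
    (a + c) % m            ≡⟨ %-distribˡ-+ a c m ⟩
    (a % m + c % m) % m    ≡⟨ cong₂ (λ u v → (u + v) % m) a≡b c≡d ⟩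
    (b % m + d % m) % m    ≡⟨ %-distribˡ-+ b d m ⟨
    (b + d) % m            ∎

  *-cong : ∀ {a b c d} → a ≡[mod m ] b → c ≡[mod m ] d → (a * c) ≡[mod m ] (b * d)
  *-cong {a} {b} {c} {d} a≡b c≡d = begin
    (a * c) % m            ≡⟨ %-distribˡ-* a c m ⟩
    (a % m * (c % m)) % m  ≡⟨ cong₂ (λ u v → (u * v) % m) a≡b c≡d ⟩
    (b % m * (d % m)) % m  ≡⟨ %-distribˡ-* b d m ⟨
    (b * d) % m            ∎

  ^-cong : ∀ {a b} k → a ≡[mod m ] b → (a ^ k) ≡[mod m ] (b ^ k)
  ^-cong zero    _   = refl
  ^-cong (suc k) a≡b = *-cong a≡b (^-cong k a≡b)

  -- adding c * m = c + c * pred m changes nothing modulo m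
  +-cancelʳ : ∀ {a b} c → (a + c) ≡[mod m ] (b + c) → a ≡[mod m ] b
  +-cancelʳ {a} {b} c a+c≡b+c = begin
    a % m                      ≡⟨ [m+kn]%n≡m%n a c m ⟨
    (a + c * m) % m            ≡⟨ cong (_% m) (add-multiple a) ⟩
    (a + c + c * pred m) % m   ≡⟨ +-cong a+c≡b+c refl ⟩
    (b + c + c * pred m) % m   ≡⟨ cong (_% m) (add-multiple b) ⟨
    (b + c * m) % m            ≡⟨ [m+kn]%n≡m%n b c m ⟩
    b % m                      ∎
    where
    add-multiple : ∀ x → x + c * m ≡ x + c + c * pred m
    add-multiple x = begin
      x + c * m                ≡⟨ cong (λ t → x + c * t) (suc-pred m) ⟨
      x + c * suc (pred m)     ≡⟨ cong (x +_) (*-suc c (pred m)) ⟩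
      x + (c + c * pred m)     ≡⟨ +-assoc x c (c * pred m) ⟨
      x + c + c * pred m       ∎

  0%m≡0 : 0 % m ≡ 0
  0%m≡0 = m*n%n≡0 0 m

  ∣⇔≡0 : ∀ y → m ∣ y ⇔ y ≡[mod m ] 0
  ∣⇔≡0 y = ⇔.trans (⇔.sym (m%n≡0⇔n∣m y m)) (mk⇔ (λ y%m≡0 → trans y%m≡0 (sym 0%m≡0))
                                                 (λ y≡0 → trans y≡0 0%m≡0))

  ≡-1⇒square≡1 : ∀ {y} → y ≡-1[mod m ] → (y * y) ≡[mod m ] 1
  ≡-1⇒square≡1 {y} y≡-1 = +-cancelʳ y (begin
    (y * y + y) % m    ≡⟨ cong (_% m) (trans (+-comm (y * y) y) (sym (*-suc y y))) ⟩
    (y * suc y) % m    ≡⟨ cong (λ t → (y * t) % m) (+-comm 1 y) ⟩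
    (y * (y + 1)) % m  ≡⟨ *-cong {y} refl y≡-1 ⟩
    (y * 0) % m        ≡⟨ cong (_% m) (*-zeroʳ y) ⟩
    0 % m              ≡⟨ y≡-1 ⟨
    (y + 1) % m        ≡⟨ cong (_% m) (+-comm y 1) ⟩
    (1 + y) % m        ∎)

  ^≡-1⇒exponent>0 : 2 < m → ∀ {x k} → x ^ k ≡-1[mod m ] → 0 < k
  ^≡-1⇒exponent>0 2<m {k = zero}  2≡0 = ⊥-elim (1+n≢0 (trans (sym (m<n⇒m%n≡m 2<m)) (trans 2≡0 0%m≡0)))
  ^≡-1⇒exponent>0 2<m {k = suc _} _ = s≤s z≤n

  ^-unit : ∀ {b b'} k → (b * b') ≡[mod m ] 1 → (b ^ k * b' ^ k) ≡[mod m ] 1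
  ^-unit {b} {b'} k bb'≡1 = begin
    (b ^ k * b' ^ k) % m   ≡⟨ cong (_% m) (^-distribʳ-* b b' k) ⟨
    (b * b') ^ k % m       ≡⟨ ^-cong k bb'≡1 ⟩
    1 ^ k % m              ≡⟨ cong (_% m) (^-zeroˡ k) ⟩
    1 % m                  ∎

  *-unit-≡0⇒≡0 : ∀ {y c c'} → (c * c') ≡[mod m ] 1 → (y * c') ≡[mod m ] 0 → y ≡[mod m ] 0
  *-unit-≡0⇒≡0 {y} {c} {c'} cc'≡1 yc'≡0 = begin
    y % m                  ≡⟨ cong (_% m) (*-identityʳ y) ⟨
    (y * 1) % m            ≡⟨ *-cong {y} refl cc'≡1 ⟨
    (y * (c * c')) % m     ≡⟨ cong (_% m) (trans (cong (y *_) (*-comm c c')) (sym (*-assoc y c' c))) ⟩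
    (y * c' * c) % m       ≡⟨ *-cong yc'≡0 (refl {x = c % m}) ⟩
    0 % m                  ∎

  -- multiplication by the unit b'ᵏ turns aᵏ + bᵏ into (a b')ᵏ + 1
  ^+^≡0⇔^≡-1 : ∀ {a b b'} k → (b * b') ≡[mod m ] 1 →
               (a ^ k + b ^ k) ≡[mod m ] 0 ⇔ (a * b') ^ k ≡-1[mod m ]
  ^+^≡0⇔^≡-1 {a} {b} {b'} k bb'≡1 = mk⇔
    (λ sum≡0 → trans (sym scaled) (*-cong sum≡0 (refl {x = b' ^ k % m})))
    (λ ab'≡-1 → *-unit-≡0⇒≡0 {c = b ^ k} (^-unit k bb'≡1) (trans scaled ab'≡-1))
    where
    scaled : ((a ^ k + b ^ k) * b' ^ k) ≡[mod m ] ((a * b') ^ k + 1)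
    scaled = begin
      ((a ^ k + b ^ k) * b' ^ k) % m         ≡⟨ cong (_% m) (*-distribʳ-+ (b' ^ k) (a ^ k) (b ^ k)) ⟩
      (a ^ k * b' ^ k + b ^ k * b' ^ k) % m  ≡⟨ +-cong (cong (_% m) (sym (^-distribʳ-* a b' k))) (^-unit k bb'≡1) ⟩
      ((a * b') ^ k + 1) % m                 ∎

InK⇔^≡-1 : ∀ {a b ℓ b'} .{{_ : NonZero ℓ}} → 2 < ℓ → (b * b') ≡[mod ℓ ] 1 →
           ∀ k → InK a b ℓ k ⇔ (a * b') ^ k ≡-1[mod ℓ ]
InK⇔^≡-1 {a} {b} {ℓ} 2<ℓ bb'≡1 k = mk⇔
  (λ (_ , ℓ∣sum) → to (^+^≡0⇔^≡-1 k bb'≡1) (to (∣⇔≡0 _) ℓ∣sum))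
  (λ ab'≡-1 → ^≡-1⇒exponent>0 2<ℓ ab'≡-1 , from (∣⇔≡0 _) (from (^+^≡0⇔^≡-1 k bb'≡1) ab'≡-1))
  where
  open ModularArithmetic ℓ
  open Equivalence

odd-multiple-expand : ∀ h q → (1 + 2 * q) * h ≡ h + q * (2 * h)
odd-multiple-expand = solve-∀

module Order {m : ℕ} .{{_ : NonZero m}} {x n : ℕ} (ord : IsOrderMod m x n) where
  open ModularArithmetic m
  open ≡-Reasoning

  instance
    n≢0 : NonZero n
    n≢0 = >-nonZero (proj₁ ord)

  ^-multiple-of-order : ∀ q → (x ^ (q * n)) ≡[mod m ] 1
  ^-multiple-of-order q = begin
    x ^ (q * n) % m    ≡⟨ cong (λ e → x ^ e % m) (*-comm q n) ⟩
    x ^ (n * q) % m    ≡⟨ cong (_% m) (^-*-assoc x n q) ⟨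
    (x ^ n) ^ q % m    ≡⟨ ^-cong q (proj₁ (proj₂ ord)) ⟩
    1 ^ q % m          ≡⟨ cong (_% m) (^-zeroˡ q) ⟩
    1 % m              ∎

  ^-periodic : ∀ r q → (x ^ (r + q * n)) ≡[mod m ] (x ^ r)
  ^-periodic r q = begin
    x ^ (r + q * n) % m      ≡⟨ cong (_% m) (^-distribˡ-+-* x r (q * n)) ⟩
    (x ^ r * x ^ (q * n)) % m ≡⟨ *-cong {x ^ r} refl (^-multiple-of-order q) ⟩
    (x ^ r * 1) % m          ≡⟨ cong (_% m) (*-identityʳ (x ^ r)) ⟩
    x ^ r % m                ∎

  ^-mod-order : ∀ k → (x ^ k) ≡[mod m ] (x ^ (k % n))
  ^-mod-order k = trans (cong (λ e → x ^ e % m) (m≡m%n+[m/n]*n k n)) (^-periodic (k % n) (k / n))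

  exponent<order⇒≡0 : ∀ {r} → r < n → (x ^ r) ≡[mod m ] 1 → r ≡ 0
  exponent<order⇒≡0 {zero}  _   _    = refl
  exponent<order⇒≡0 {suc r} r<n xʳ≡1 = ⊥-elim (<⇒≱ r<n (proj₂ (proj₂ ord) (suc r) (s≤s z≤n) xʳ≡1))

  order-∣ : ∀ {j} → (x ^ j) ≡[mod m ] 1 → n ∣ j
  order-∣ {j} xʲ≡1 = Equivalence.to (m%n≡0⇔n∣m j n)
    (exponent<order⇒≡0 (m%n<n j n) (trans (sym (^-mod-order j)) xʲ≡1))

  ^≡-1⇒residue≡-1 : ∀ {k} → x ^ k ≡-1[mod m ] → x ^ (k % n) ≡-1[mod m ]
  ^≡-1⇒residue≡-1 {k} xᵏ≡-1 = trans (+-cong (sym (^-mod-order k)) (refl {x = 1 % m})) xᵏ≡-1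

  ^odd-multiple≡-1 : ∀ {h} → n ≡ 2 * h → x ^ h ≡-1[mod m ] → ∀ α → x ^ ((1 + 2 * α) * h) ≡-1[mod m ]
  ^odd-multiple≡-1 {h} n≡2h xʰ≡-1 α = trans (+-cong xᵏ≡xʰ (refl {x = 1 % m})) xʰ≡-1
    where
    xᵏ≡xʰ : (x ^ ((1 + 2 * α) * h)) ≡[mod m ] (x ^ h)
    xᵏ≡xʰ = trans (cong (λ e → x ^ e % m) (trans (odd-multiple-expand h α) (cong (λ t → h + α * t) (sym n≡2h))))
                  (^-periodic h α)

  module _ (2<m : 2 < m) where

    ^≡-1⇒order≡2*residue : ∀ {k} → x ^ k ≡-1[mod m ] → n ≡ 2 * (k % n)
    ^≡-1⇒order≡2*residue {k} xᵏ≡-1 = n∣2r⇒n≡2r (^≡-1⇒exponent>0 2<m xʳ≡-1) (m%n<n k n) (order-∣ x²ʳ≡1)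
      where
      r = k % n
      xʳ≡-1 : x ^ r ≡-1[mod m ]
      xʳ≡-1 = ^≡-1⇒residue≡-1 xᵏ≡-1
      x²ʳ≡1 : (x ^ (2 * r)) ≡[mod m ] 1
      x²ʳ≡1 = trans (cong (_% m) (trans (cong (λ e → x ^ (r + e)) (+-identityʳ r)) (^-distribˡ-+-* x r r)))
                    (≡-1⇒square≡1 xʳ≡-1)

    ^≡-1⇔odd-multiple : ∀ {h} → n ≡ 2 * h → x ^ h ≡-1[mod m ] →
                        ∀ k → x ^ k ≡-1[mod m ] ⇔ (∃[ α ] k ≡ (1 + 2 * α) * h)
    ^≡-1⇔odd-multiple {h} n≡2h xʰ≡-1 k = mk⇔ odd-multiple
      (λ (α , k≡[1+2α]h) → subst (λ e → x ^ e ≡-1[mod m ]) (sym k≡[1+2α]h) (^odd-multiple≡-1 {h} n≡2h xʰ≡-1 α))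
      where
      odd-multiple : x ^ k ≡-1[mod m ] → ∃[ α ] k ≡ (1 + 2 * α) * h
      odd-multiple xᵏ≡-1 = k / n , (begin
        k                      ≡⟨ m≡m%n+[m/n]*n k n ⟩
        k % n + k / n * n      ≡⟨ cong₂ (λ r t → r + k / n * t) k%n≡h n≡2h ⟩
        h + k / n * (2 * h)    ≡⟨ odd-multiple-expand h (k / n) ⟨
        (1 + 2 * (k / n)) * h  ∎)
        where
        k%n≡h : k % n ≡ h
        k%n≡h = *-cancelˡ-≡ (k % n) h 2 (trans (sym (^≡-1⇒order≡2*residue xᵏ≡-1)) n≡2h)

lemma2p11 : (a b ℓ : ℕ) → .{{_ : NonZero ℓ}} →
    1 ≤ a → 1 ≤ b → Coprime a b →
    Good a b ℓ → ℓ ≢ 1 → ℓ ≢ 2 →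
    (b' : ℕ) → IsInverseMod ℓ b b' →
    (n : ℕ) → IsOrderMod ℓ (a * b') n →
    ∃[ m ] (n ≡ 2 * m
      × InK a b ℓ m × (∀ k → InK a b ℓ k → m ≤ k)
      × (∀ k → InK a b ℓ k ⇔ (∃[ α ] (k ≡ (1 + 2 * α) * m)))
      × (∀ N → ∃[ k ] (N < k × InK a b ℓ k)))
lemma2p11 a b ℓ _ _ _ (_ , k₀ , k₀∈K) ℓ≢1 ℓ≢2 b' bb'≡1 n ord =
  h , n≡2h , h∈K , h-least , K⇔odd , K-unbounded
  where
  open Order ord
  open Equivalence
  2<ℓ : 2 < ℓ
  2<ℓ = ≢1∧≢2⇒2< ℓ ℓ≢1 ℓ≢2
  xᵏ⁰≡-1 : (a * b') ^ k₀ ≡-1[mod ℓ ]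
  xᵏ⁰≡-1 = to (InK⇔^≡-1 2<ℓ bb'≡1 k₀) k₀∈K
  h : ℕ
  h = k₀ % n
  n≡2h : n ≡ 2 * h
  n≡2h = ^≡-1⇒order≡2*residue 2<ℓ xᵏ⁰≡-1
  K⇔odd : ∀ k → InK a b ℓ k ⇔ (∃[ α ] k ≡ (1 + 2 * α) * h)
  K⇔odd k = ⇔.trans (InK⇔^≡-1 2<ℓ bb'≡1 k) (^≡-1⇔odd-multiple 2<ℓ n≡2h (^≡-1⇒residue≡-1 xᵏ⁰≡-1) k)
  h∈K : InK a b ℓ h
  h∈K = from (K⇔odd h) (0 , sym (+-identityʳ h))
  h-least : ∀ k → InK a b ℓ k → h ≤ k
  h-least k k∈K with to (K⇔odd k) k∈K
  ... | α , k≡[1+2α]h = subst (h ≤_) (sym k≡[1+2α]h) (m≤m+n h (2 * α * h))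
  K-unbounded : ∀ N → ∃[ k ] (N < k × InK a b ℓ k)
  K-unbounded N = (1 + 2 * N) * h , N<[1+2N]h , from (K⇔odd _) (N , refl)
    where
    N<[1+2N]h : N < (1 + 2 * N) * h
    N<[1+2N]h = ≤-trans (s≤s (m≤m+n N (N + 0))) (m≤m*n (1 + 2 * N) h {{>-nonZero (proj₁ h∈K)}})
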